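{- Suppose $f\in{}^\omega\omega$, $y,z\in{}^\omega(\omega\setminus\{0\})$, and $\langle x_n : n\in\omega\rangle$ is a sequence of elements of ${}^\omega(\omega\setminus\{0\})$ with $x_n\ll x_{n+1}\ll y\ll z$ for all $n$. Suppose for every $n\in\omega$ we have $x_n^*\in{}^\omega(\omega\setminus\{0\})$ with $x_n^*\ll x_n\ll x_{n+1}^*$, and $\langle x_{n,j} : n,j\in\omega\rangle$ is a sequence of elements of ${}^\omega(\omega\setminus\{0\})$ such that $x_n\ll x_{n,j}\ll x_{n,j+1}\ll x_{n+1}^*$ for all $n,j$. Suppose $\langle T_{n,j} : n,j\in\omega\rangle$ is such that each $T_{n,j}$ is an $x_{n,j}$-sized tree. Then there are trees $\langle T^n : n\in\omega\rangle$ and $T^*$ such that $T^*$ is a $z$-sized tree, $f\in[T^0]$, $T^0\subseteq T^*$, and for every $n\in\omega$: (i) $T^n\subseteq T^{n+1}$ and $T^n$ is an $x_n$-sized tree; (ii) for every $j\in\omega$ and every $g\in[T_{n,j}]$ there is $k\in\omega$ such that for every $\eta\in{}^{<\omega}\omega$ extending $g\restriction k$, if $\eta\in T_{n,j}$ and $\eta\restriction k\in T^n\cap T^*$ then $\eta\in T^{n+1}\cap T^*$.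
   Context: A tree is a subset $T\subseteq{}^{<\omega}\omega$ closed under initial segments. For $x\in{}^\omega(\omega\setminus\{0\})$, $T$ is an $x$-sized tree if $|T\cap{}^n\omega|\leq x(n)$ for every $n\in\omega$. $[T]$ is the set of $f\in{}^\omega\omega$ all of whose finite initial segments lie in $T$. For $x,y\in{}^\omega(\omega\setminus\{0\})$, $x\ll y$ means $x(n)\leq y(n)$ for all $n$ and $\lim_{n\to\infty}y(n)/x(n)=\infty$. -}

module Defs where

open import Data.Nat using (ℕ; zero; suc; _+_; _*_; _≤_; _<_)
open import Data.List using (List; length; take; map; upTo; _++_)
open import Data.List.Relation.Unary.All using (All)
open import Data.List.Relation.Unary.Unique.Propositional using (Unique)
open import Data.Product using (Σ; ∃; _×_)
open import Relation.Binary.PropositionalEquality using (_≡_)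

Pos : (ℕ → ℕ) → Set
Pos x = ∀ n → 0 < x n

-- x ≪ y : x(n) ≤ y(n) for all n, and lim y(n)/x(n) = ∞, i.e.
-- for every M there is N with y(n)/x(n) ≥ M (⇔ M·x(n) ≤ y(n), as x(n) > 0) for all n ≥ N.
_≪_ : (ℕ → ℕ) → (ℕ → ℕ) → Set
x ≪ y = (∀ n → x n ≤ y n) × (∀ M → ∃ λ N → ∀ n → N ≤ n → M * x n ≤ y n)

-- finite sequences ^{<ω}ω are lists; a set of them is a predicate
SeqSet : Set₁
SeqSet = List ℕ → Set

IsTree : SeqSet → Set
IsTree T = ∀ s n → T s → T (take n s)

-- |T ∩ ^nω| ≤ x(n): every duplicate-free list of length-n members of T has length ≤ x(n)
Sized : (ℕ → ℕ) → SeqSet → Set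
Sized x T = ∀ n (l : List (List ℕ)) → Unique l →
            All (λ s → length s ≡ n × T s) l → length l ≤ x n

restrict : (ℕ → ℕ) → ℕ → List ℕ
restrict g k = map g (upTo k)

Branch : (ℕ → ℕ) → SeqSet → Set
Branch g T = ∀ k → T (restrict g k)

_⊆ₛ_ : SeqSet → SeqSet → Set
S ⊆ₛ T = ∀ s → S s → T s

Extends : List ℕ → List ℕ → Set
Extends η s = ∃ λ r → η ≡ s ++ r

-- T⁰ is the set of initial segments of f, and T^{n+1} adds to T^n every node η of
-- some T_{n,j} of height ≥ k_{n,j} with η ↾ k_{n,j} ∈ T^n; this gives (ii) with
-- k = k_{n,j}. The thresholds k_{n,j} increase strictly in j and exceed the point
-- from which (j+2)·x_{n,j+1} ≤ x*_{n+1}. At a height m with k_{n,J} ≤ m < k_{n,J+1}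
-- only T_{n,0}, …, T_{n,J} contribute, so T^{n+1} has at most
-- x_n(m) + (J+1)·x_{n,J}(m) ≤ (J+2)·x_{n,J+1}(m) ≤ x*_{n+1}(m) ≤ x_{n+1}(m) nodes
-- there. Since k_{n,0} > n, a node of height m of T* = ⋃ₙ Tⁿ already lies in T^m,
-- so T* has at most x_m(m) ≤ y(m) ≤ z(m) nodes of height m.
module Submission where

open import Defs
open import Data.Nat using (ℕ; zero; suc; _+_; _*_; _≤_; _<_; _≤′_; ≤′-reflexive; ≤′-step; z≤n; s≤s; _≤?_; _⊓_)
open import Data.Nat.Properties
open import Data.List using (List; []; _∷_; take; length; map; applyUpTo; upTo)
open import Data.List.Properties using (length-map; length-upTo; length-take; length-++-≤ˡ; take-map; take-take)
open import Data.List.Relation.Unary.All as All using (All; []; _∷_)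
open import Data.List.Relation.Unary.AllPairs using ([]; _∷_)
open import Data.List.Relation.Unary.Unique.Propositional using (Unique)
open import Data.List.Relation.Binary.Sublist.Propositional using ([]; _∷_; _∷ʳ_) renaming (_⊆_ to _⊑_)
open import Data.List.Relation.Binary.Sublist.Propositional.Properties using (All-resp-⊆)
open import Data.Product using (Σ; ∃; ∃₂; _×_; _,_; proj₁; proj₂)
open import Data.Sum using (_⊎_; inj₁; inj₂)
open import Level using (0ℓ)
open import Relation.Nullary using (yes; no; contradiction)
open import Relation.Unary using (Pred; _⊆_; _∪_)
open import Relation.Binary.PropositionalEquality using (_≡_; refl; sym; trans; cong; subst)

AtMost : {A : Set} → ℕ → Pred A 0ℓ → Set
AtMost c P = ∀ l → Unique l → All P l → length l ≤ c

module _ {A : Set} where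

  Unique-resp-⊑ : {xs ys : List A} → xs ⊑ ys → Unique ys → Unique xs
  Unique-resp-⊑ []         []          = []
  Unique-resp-⊑ (_ ∷ʳ τ)   (_ ∷ u)     = Unique-resp-⊑ τ u
  Unique-resp-⊑ (refl ∷ τ) (x∉xs ∷ u) = All-resp-⊆ τ x∉xs ∷ Unique-resp-⊑ τ u

  partition-All : {P Q : Pred A 0ℓ} (l : List A) → All (P ∪ Q) l →
    ∃₂ λ l₁ l₂ → l₁ ⊑ l × l₂ ⊑ l × All P l₁ × All Q l₂ × length l ≡ length l₁ + length l₂
  partition-All [] [] = [] , [] , [] , [] , [] , [] , refl
  partition-All (x ∷ l) (inj₁ p ∷ ps) with partition-All l ps
  ... | l₁ , l₂ , τ₁ , τ₂ , ps₁ , qs₂ , eq =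
    x ∷ l₁ , l₂ , refl ∷ τ₁ , x ∷ʳ τ₂ , p ∷ ps₁ , qs₂ , cong suc eq
  partition-All (x ∷ l) (inj₂ q ∷ ps) with partition-All l ps
  ... | l₁ , l₂ , τ₁ , τ₂ , ps₁ , qs₂ , eq =
    l₁ , x ∷ l₂ , x ∷ʳ τ₁ , refl ∷ τ₂ , ps₁ , q ∷ qs₂ ,
    trans (cong suc eq) (sym (+-suc (length l₁) (length l₂)))

  AtMost-mono : ∀ {a b} {P : Pred A 0ℓ} → a ≤ b → AtMost a P → AtMost b P
  AtMost-mono a≤b hP l u ps = ≤-trans (hP l u ps) a≤b

  AtMost-⊆ : ∀ {c} {P Q : Pred A 0ℓ} → P ⊆ Q → AtMost c Q → AtMost c P
  AtMost-⊆ P⊆Q hQ l u ps = hQ l u (All.map P⊆Q ps)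

  AtMost-∪ : ∀ {a b} {P Q : Pred A 0ℓ} → AtMost a P → AtMost b Q → AtMost (a + b) (P ∪ Q)
  AtMost-∪ hP hQ l u ps with partition-All l ps
  ... | l₁ , l₂ , τ₁ , τ₂ , ps₁ , qs₂ , eq = begin
    length l                 ≡⟨ eq ⟩
    length l₁ + length l₂    ≤⟨ +-mono-≤ (hP l₁ (Unique-resp-⊑ τ₁ u) ps₁) (hQ l₂ (Unique-resp-⊑ τ₂ u) qs₂) ⟩
    _                        ∎
    where open ≤-Reasoning

  AtMost-⋃< : ∀ {c} {Q : ℕ → Pred A 0ℓ} J → (∀ j → j < J → AtMost c (Q j)) →
    AtMost (J * c) (λ x → ∃ λ j → j < J × Q j x)
  AtMost-⋃< zero    _  []      _ []                = z≤n
  AtMost-⋃< zero    _  (_ ∷ _) _ ((_ , () , _) ∷ _)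
  AtMost-⋃< {Q = Q} (suc J) hQ =
    AtMost-⊆ split (AtMost-∪ (hQ J ≤-refl) (AtMost-⋃< J (λ j j<J → hQ j (m<n⇒m<1+n j<J))))
    where
    split : (λ x → ∃ λ j → j < suc J × Q j x) ⊆ (Q J ∪ λ x → ∃ λ j → j < J × Q j x)
    split (j , j<1+J , q) with m<1+n⇒m<n∨m≡n j<1+J
    ... | inj₁ j<J  = inj₂ (j , j<J , q)
    ... | inj₂ refl = inj₁ q

  AtMost-subsingleton : {P : Pred A 0ℓ} → (∀ {x y} → P x → P y → x ≡ y) → AtMost 1 P
  AtMost-subsingleton _ []          _                  _                = z≤n
  AtMost-subsingleton _ (_ ∷ [])    _                  _                = s≤s z≤n
  AtMost-subsingleton P-unique (_ ∷ _ ∷ _) ((x≢y ∷ _) ∷ _) (px ∷ py ∷ _) =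
    contradiction (P-unique px py) x≢y

module _ {f : ℕ → ℕ} where

  ascending-mono : (∀ j → f j ≤ f (suc j)) → ∀ {i j} → i ≤ j → f i ≤ f j
  ascending-mono step i≤j = go (≤⇒≤′ i≤j)
    where
    go : ∀ {i j} → i ≤′ j → f i ≤ f j
    go (≤′-reflexive refl) = ≤-refl
    go (≤′-step i≤′j)      = ≤-trans (go i≤′j) (step _)

  ascending-< : (∀ j → f j ≤ f (suc j)) → ∀ {i j m} → f i ≤ m → m < f j → i < j
  ascending-< step fi≤m m<fj =
    ≰⇒> (λ j≤i → <⇒≱ (≤-<-trans fi≤m m<fj) (ascending-mono step j≤i))

  bracket : (∀ j → f j < f (suc j)) → ∀ m → m < f 0 ⊎ ∃ λ J → f J ≤ m × m < f (suc J)
  bracket f-< m = search (suc m) (id≤f (suc m))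
    where
    id≤f : ∀ j → j ≤ f j
    id≤f zero    = z≤n
    id≤f (suc j) = ≤-trans (s≤s (id≤f j)) (f-< j)

    search : ∀ c → m < f c → m < f 0 ⊎ ∃ λ J → f J ≤ m × m < f (suc J)
    search zero    m<f0   = inj₁ m<f0
    search (suc c) m<fc+1 with f c ≤? m
    ... | yes fc≤m = inj₂ (c , fc≤m , m<fc+1)
    ... | no  fc≰m = search c (≰⇒> fc≰m)

take-take-≤ : ∀ {A : Set} {m n} (xs : List A) → m ≤ n → take m (take n xs) ≡ take m xs
take-take-≤ {m = m} {n} xs m≤n = trans (take-take m n xs) (cong (λ i → take i xs) (m≤n⇒m⊓n≡m m≤n))

take-applyUpTo : ∀ {A : Set} (g : ℕ → A) n m → take n (applyUpTo g m) ≡ applyUpTo g (n ⊓ m)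
take-applyUpTo g zero    m       = refl
take-applyUpTo g (suc n) zero    = refl
take-applyUpTo g (suc n) (suc m) = cong (g 0 ∷_) (take-applyUpTo (λ i → g (suc i)) n m)

take-restrict : ∀ g n m → take n (restrict g m) ≡ restrict g (n ⊓ m)
take-restrict g n m = trans (take-map n (upTo m)) (cong (map g) (take-applyUpTo (λ i → i) n m))

length-restrict : ∀ g k → length (restrict g k) ≡ k
length-restrict g k = trans (length-map g (upTo k)) (length-upTo k)

Extends⇒length≤ : ∀ {η s} → Extends η s → length s ≤ length η
Extends⇒length≤ {s = s} (_ , refl) = length-++-≤ˡ s

level : ℕ → SeqSet → SeqSet
level m T s = length s ≡ m × T s

segments : (ℕ → ℕ) → SeqSet
segments f s = ∃ λ k → s ≡ restrict f k

segments-isTree : ∀ f → IsTree (segments f)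
segments-isTree f _ n (k , refl) = n ⊓ k , take-restrict f n k

segments-width : ∀ f m → AtMost 1 (level m (segments f))
segments-width f m = AtMost-subsingleton λ p q → trans (at-m p) (sym (at-m q))
  where
  at-m : ∀ {s} → level m (segments f) s → s ≡ restrict f m
  at-m (|s|≡m , k , refl) = cong (restrict f) (trans (sym (length-restrict f k)) |s|≡m)

graft : SeqSet → (ℕ → SeqSet) → (ℕ → ℕ) → SeqSet
graft A T k s = A s ⊎ ∃ λ j → k j ≤ length s × T j s × A (take (k j) s)

module _ {A : SeqSet} {T : ℕ → SeqSet} {k : ℕ → ℕ} where

  graft-isTree : IsTree A → (∀ j → IsTree (T j)) → IsTree (graft A T k)
  graft-isTree A-tree _ s n (inj₁ p) = inj₁ (A-tree s n p)
  graft-isTree A-tree T-tree s n (inj₂ (j , kj≤|s| , t , p)) with k j ≤? n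
  ... | yes kj≤n =
    inj₂ (j , subst (k j ≤_) (sym (length-take n s)) (⊓-glb kj≤n kj≤|s|) ,
          T-tree j s n t , subst A (sym (take-take-≤ s kj≤n)) p)
  ... | no kj≰n =
    inj₁ (subst A (take-take-≤ s (<⇒≤ (≰⇒> kj≰n))) (A-tree (take (k j) s) n p))

  graft-below : ∀ {s} → (∀ j → length s < k j) → graft A T k s → A s
  graft-below _     (inj₁ p)                 = p
  graft-below short (inj₂ (j , kj≤|s| , _)) = contradiction kj≤|s| (<⇒≱ (short j))

  graft-width : ∀ {m J a c} → (∀ j → k j ≤ m → j < J) →
    AtMost a (level m A) → (∀ j → j < J → AtMost c (level m (T j))) →
    AtMost (a + J * c) (level m (graft A T k))
  graft-width {m} {J} early hA hT = AtMost-⊆ cover (AtMost-∪ hA (AtMost-⋃< J hT))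
    where
    cover : level m (graft A T k) ⊆ (level m A ∪ λ s → ∃ λ j → j < J × level m (T j) s)
    cover (|s|≡m , inj₁ p)                 = inj₁ (|s|≡m , p)
    cover (refl  , inj₂ (j , kj≤m , t , _)) = inj₂ (j , early j kj≤m , refl , t)

module Construction
    (f : ℕ → ℕ) (y z : ℕ → ℕ) (x : ℕ → ℕ → ℕ) (x₀-pos : Pos (x 0))
    (x≪x : ∀ n → x n ≪ x (suc n)) (x≪y : ∀ n → x (suc n) ≪ y) (y≪z : y ≪ z)
    (xs : ℕ → ℕ → ℕ) (xs≪x : ∀ n → xs n ≪ x n)
    (xx : ℕ → ℕ → ℕ → ℕ) (x≪xx : ∀ n j → x n ≪ xx n j) (xx≪xx : ∀ n j → xx n j ≪ xx n (suc j))
    (xx≪xs : ∀ n j → xx n (suc j) ≪ xs (suc n))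
    (T : ℕ → ℕ → SeqSet) (T-tree : ∀ n j → IsTree (T n j))
    (T-sized : ∀ n j → Sized (xx n j) (T n j)) where

  N : ℕ → ℕ → ℕ
  N n j = proj₁ (proj₂ (xx≪xs n j) (suc (suc j)))

  k : ℕ → ℕ → ℕ
  k n zero    = suc n + N n 0
  k n (suc j) = suc (k n j + N n (suc j))

  k-< : ∀ n j → k n j < k n (suc j)
  k-< n j = s≤s (m≤m+n _ _)

  k-ascending : ∀ n j → k n j ≤ k n (suc j)
  k-ascending n j = <⇒≤ (k-< n j)

  N≤k : ∀ n j → N n j ≤ k n j
  N≤k n zero    = m≤n+m _ _
  N≤k n (suc j) = m≤n⇒m≤1+n (m≤n+m _ _)

  n<k : ∀ n j → n < k n j
  n<k n j = ≤-trans (m≤m+n (suc n) (N n 0)) (ascending-mono {f = k n} (k-ascending n) {j = j} z≤n)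

  Tn : ℕ → SeqSet
  Tn zero    = segments f
  Tn (suc n) = graft (Tn n) (T n) (k n)

  Tstar : SeqSet
  Tstar s = ∃ λ n → Tn n s

  Tn-isTree : ∀ n → IsTree (Tn n)
  Tn-isTree zero    = segments-isTree f
  Tn-isTree (suc n) = graft-isTree (Tn-isTree n) (T-tree n)

  Tstar-isTree : IsTree Tstar
  Tstar-isTree s i (n , p) = n , Tn-isTree n s i p

  Tn-mono : ∀ {i j} → i ≤′ j → Tn i ⊆ Tn j
  Tn-mono (≤′-reflexive refl) p = p
  Tn-mono (≤′-step i≤′j)      p = inj₁ (Tn-mono i≤′j p)

  Tn-settle : ∀ n {s} → Tn n s → Tn (length s) s
  Tn-settle n {s} p with n ≤? length s
  ... | yes n≤|s| = Tn-mono (≤⇒≤′ n≤|s|) p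
  Tn-settle zero    p | no n≰|s| = contradiction z≤n n≰|s|
  Tn-settle (suc n) {s} p | no n≰|s| =
    Tn-settle n (graft-below {A = Tn n} {T = T n} {k = k n} (λ j → ≤-trans (≰⇒> n≰|s|) (n<k n j)) p)

  Tn-capture : ∀ n j g η → Extends η (restrict g (k n j)) → T n j η →
    Tn n (take (k n j) η) → Tn (suc n) η
  Tn-capture n j g η ext t p =
    inj₂ (j , subst (_≤ length η) (length-restrict g (k n j)) (Extends⇒length≤ ext) , t , p)

  xx-mono : ∀ n {i j} → i ≤ j → ∀ m → xx n i m ≤ xx n j m
  xx-mono n i≤j m = ascending-mono (λ j → proj₁ (xx≪xx n j) m) i≤j

  width-budget : ∀ n J m → k n J ≤ m → x n m + suc J * xx n J m ≤ x (suc n) m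
  width-budget n J m kJ≤m = begin
    x n m + suc J * xx n J m       ≤⟨ +-monoˡ-≤ _ (proj₁ (x≪xx n J) m) ⟩
    suc (suc J) * xx n J m         ≤⟨ *-monoʳ-≤ (suc (suc J)) (proj₁ (xx≪xx n J) m) ⟩
    suc (suc J) * xx n (suc J) m   ≤⟨ proj₂ (proj₂ (xx≪xs n J) (suc (suc J))) m (≤-trans (N≤k n J) kJ≤m) ⟩
    xs (suc n) m                   ≤⟨ proj₁ (xs≪x (suc n)) m ⟩
    x (suc n) m                    ∎
    where open ≤-Reasoning

  Tn-sized : ∀ n → Sized (x n) (Tn n)
  Tn-sized zero    m = AtMost-mono (x₀-pos m) (segments-width f m)
  Tn-sized (suc n) m with bracket (k-< n) m
  ... | inj₁ m<k₀ =
    AtMost-mono (≤-trans (≤-reflexive (+-identityʳ (x n m))) (proj₁ (x≪x n) m))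
      (graft-width {J = 0} {c = 0} (λ j kj≤m → ascending-< (k-ascending n) kj≤m m<k₀)
        (Tn-sized n m) (λ _ ()))
  ... | inj₂ (J , kJ≤m , m<kJ+1) =
    AtMost-mono (width-budget n J m kJ≤m)
      (graft-width (λ j kj≤m → ascending-< (k-ascending n) kj≤m m<kJ+1)
        (Tn-sized n m) (λ j j<1+J → AtMost-mono (xx-mono n (≤-pred j<1+J) m) (T-sized n j m)))

  Tstar-sized : Sized z Tstar
  Tstar-sized m =
    AtMost-mono (≤-trans (proj₁ (x≪x m) m) (≤-trans (proj₁ (x≪y m) m) (proj₁ y≪z m)))
      (AtMost-⊆ (λ { (refl , n , p) → refl , Tn-settle n p }) (Tn-sized m m))

lemma4p7 : (f : ℕ → ℕ) (y z : ℕ → ℕ) → Pos y → Pos z →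
    (x : ℕ → ℕ → ℕ) → (∀ n → Pos (x n)) →
    (∀ n → x n ≪ x (suc n)) → (∀ n → x (suc n) ≪ y) → y ≪ z →
    (xs : ℕ → ℕ → ℕ) → (∀ n → Pos (xs n)) →
    (∀ n → xs n ≪ x n) → (∀ n → x n ≪ xs (suc n)) →
    (xx : ℕ → ℕ → ℕ → ℕ) → (∀ n j → Pos (xx n j)) →
    (∀ n j → x n ≪ xx n j) → (∀ n j → xx n j ≪ xx n (suc j)) →
    (∀ n j → xx n (suc j) ≪ xs (suc n)) →
    (T : ℕ → ℕ → SeqSet) → (∀ n j → IsTree (T n j)) →
    (∀ n j → Sized (xx n j) (T n j)) →
    Σ (ℕ → SeqSet) λ Tn → Σ SeqSet λ Tstar →
      (∀ n → IsTree (Tn n)) × IsTree Tstar × Sized z Tstar ×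
      Branch f (Tn 0) × (Tn 0 ⊆ₛ Tstar) ×
      (∀ n →
        ((Tn n ⊆ₛ Tn (suc n)) × Sized (x n) (Tn n)) ×
        (∀ j (g : ℕ → ℕ) → Branch g (T n j) →
          ∃ λ k → ∀ (η : List ℕ) → Extends η (restrict g k) → T n j η →
            Tn n (take k η) → Tstar (take k η) → Tn (suc n) η × Tstar η))
lemma4p7 f y z _ _ x x-pos x≪x x≪y y≪z xs _ xs≪x _ xx _ x≪xx xx≪xx xx≪xs T T-tree T-sized =
  Tn , Tstar , Tn-isTree , Tstar-isTree , Tstar-sized ,
  (λ i → i , refl) , (λ _ p → 0 , p) ,
  λ n → ((λ _ → inj₁) , Tn-sized n) ,
    λ j g _ → k n j , λ η ext t p _ →
      let captured = Tn-capture n j g η ext t p in captured , (suc n , captured)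
  where
  open Construction f y z x (x-pos 0) x≪x x≪y y≪z xs xs≪x xx x≪xx xx≪xx xx≪xs T T-tree T-sized
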